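{- Let $M=(E,r)$ be a $q$-matroid, let $F$ be a cyclic flat of $M$, and let $G<F$ be a subspace. Then $F/G$ is a cyclic flat of the contraction $M/G=(E/G,r_{M/G})$.
   Context: Let $q$ be a prime power and $E$ an $n$-dimensional $\mathbb{F}_q$-vector space. A $q$-matroid $(E,r)$ is a function $r$ from subspaces of $E$ to $\mathbb{Z}$ with (R1) $0\le r(A)\le\dim A$, (R2) $r(A)\le r(B)$ if $A\le B$, (R3) $r(A+B)+r(A\cap B)\le r(A)+r(B)$. For a subspace $G\le E$, the contraction $M/G$ is the $q$-matroid on $E/G$ whose rank function is $r_{M/G}(T/G)=r(T)-r(G)$ for subspaces $G\le T\le E$. In a $q$-matroid with rank function $\rho$ on ground space $W$: a flat is a subspace $F$ with $\rho(F+x)>\rho(F)$ for all $1$-dimensional $x\le W$, $x\not\le F$; a subspace $A$ is cyclic if $\rho(B)=\rho(A)$ for every $B\le A$ of codimension $1$ in $A$; a cyclic flat is a subspace that is both. -}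

module Defs where

open import Level using (0ℓ)
open import Algebra.Bundles using (CommutativeRing)
open import Data.Nat using (ℕ; zero; suc; _≤_; _<_; _∸_; _+_; _^_)
open import Data.Nat.Primality using (Prime)
open import Data.Fin using (Fin; zero; suc)
open import Data.Product using (Σ; ∃; ∃₂; _×_; _,_)
open import Relation.Nullary using (¬_)
open import Relation.Binary.PropositionalEquality using (_≡_)

record FiniteField : Set₁ where
  field
    cring : CommutativeRing 0ℓ 0ℓ
  open CommutativeRing cring public
  field
    0≉1       : ¬ (0# ≈ 1#)
    inverse   : ∀ x → ¬ (x ≈ 0#) → ∃ λ y → (x * y) ≈ 1#
    size      : ℕ
    enum      : Fin size → Carrier
    enum-surj : ∀ x → ∃ λ i → enum i ≈ x
    enum-inj  : ∀ i j → enum i ≈ enum j → i ≡ j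

IsPrimePower : ℕ → Set
IsPrimePower q = ∃₂ λ p k → Prime p × q ≡ p ^ suc k

-- This is only
-- instantiated with genuine vector spaces below: E = K^n and E/G.

module _ (K : FiniteField) where
  open FiniteField K using (0#; -_) renaming (Carrier to 𝕂; _≈_ to _≈K_; _+_ to _+K_; _*_ to _*K_)

  record LinSpace : Set₁ where
    field
      V    : Set
      _≈_  : V → V → Set
      _⊕_  : V → V → V
      _⊙_  : 𝕂 → V → V
      𝟘    : V

  module _ (W : LinSpace) where
    open LinSpace W

    Pred : Set₁
    Pred = V → Set

    IsSubspace : Pred → Set
    IsSubspace A =
        (∀ x y → x ≈ y → A x → A y)
      × A 𝟘
      × (∀ x y → A x → A y → A (x ⊕ y))
      × (∀ c x → A x → A (c ⊙ x))

    _⊆_ : Pred → Pred → Set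
    A ⊆ B = ∀ x → A x → B x

    _+ₛ_ : Pred → Pred → Pred
    (A +ₛ B) x = ∃₂ λ a b → A a × B b × ((a ⊕ b) ≈ x)

    _∩ₛ_ : Pred → Pred → Pred
    (A ∩ₛ B) x = A x × B x

    lc : (d : ℕ) → (Fin d → 𝕂) → (Fin d → V) → V
    lc zero    c v = 𝟘
    lc (suc d) c v = (c zero ⊙ v zero) ⊕ lc d (λ i → c (suc i)) (λ i → v (suc i))

    HasDim : Pred → ℕ → Set
    HasDim A d = Σ (Fin d → V) λ v →
        (∀ i → A (v i))
      × (∀ c → lc d c v ≈ 𝟘 → ∀ i → c i ≈K 0#)
      × (∀ x → A x → ∃ λ c → lc d c v ≈ x)

    CodimOne : Pred → Pred → Set
    CodimOne B A = ∃ λ d → HasDim A (suc d) × HasDim B d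

    IsFlat : (Pred → ℕ) → Pred → Set₁
    IsFlat ρ F = IsSubspace F ×
      (∀ x → IsSubspace x → HasDim x 1 → ¬ (x ⊆ F) → ρ F < ρ (F +ₛ x))

    IsCyclic : (Pred → ℕ) → Pred → Set₁
    IsCyclic ρ A = IsSubspace A ×
      (∀ B → IsSubspace B → B ⊆ A → CodimOne B A → ρ B ≡ ρ A)

    IsCyclicFlat : (Pred → ℕ) → Pred → Set₁
    IsCyclicFlat ρ F = IsFlat ρ F × IsCyclic ρ F

  E : ℕ → LinSpace
  E n = record
    { V   = Fin n → 𝕂
    ; _≈_ = λ x y → ∀ i → x i ≈K y i
    ; _⊕_ = λ x y i → x i +K y i
    ; _⊙_ = λ c x i → c *K x i
    ; 𝟘   = λ i → 0#
    }

  -- A subspace of E/G is thus represented by the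
  -- (G-saturated) set of its representatives, i.e. by T with G ≤ T ≤ E,
  -- standing for T/G.
  _/_ : (n : ℕ) → Pred (E n) → LinSpace
  n / G = record
    { V   = Fin n → 𝕂
    ; _≈_ = λ x y → G (λ i → x i +K (- y i))
    ; _⊕_ = λ x y i → x i +K y i
    ; _⊙_ = λ c x i → c *K x i
    ; 𝟘   = λ i → 0#
    }

  record QMatroid (n : ℕ) : Set₁ where
    field
      r  : Pred (E n) → ℕ
      R1 : ∀ A d → IsSubspace (E n) A → HasDim (E n) A d → r A ≤ d
      R2 : ∀ A B → IsSubspace (E n) A → IsSubspace (E n) B →
           _⊆_ (E n) A B → r A ≤ r B
      R3 : ∀ A B → IsSubspace (E n) A → IsSubspace (E n) B →
           r (_+ₛ_ (E n) A B) + r (_∩ₛ_ (E n) A B) ≤ r A + r B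

  contractionRank : ∀ {n} (M : QMatroid n) (G : Pred (E n)) → Pred (n / G) → ℕ
  contractionRank M G T = QMatroid.r M T ∸ QMatroid.r M G

  quotSub : ∀ {n} (F G : Pred (E n)) → Pred (n / G)
  quotSub F G = F

{-# OPTIONS --safe #-}
module Submission where

-- Flatness: if a line x of E/G is not contained in F/G, a generator b of x lies outside F,
-- so r F < r (F + ⟨b⟩) ≤ r (F + x) by flatness of F and monotonicity; subtracting r G
-- (which is at most r F) keeps the strict inequality.  Cyclicity: adjoining a basis of G
-- to bases of F/G and B/G turns a hyperplane B/G of F/G into a hyperplane B of F, and
-- cyclicity of F gives r B = r F.

open import Defs
open import Data.Nat using (ℕ; zero; suc; _<_; _∸_) renaming (_+_ to _+ℕ_; _≟_ to _≟ℕ_)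
open import Data.Nat.Properties using (∸-monoˡ-<; <-≤-trans)
open import Data.Fin using (Fin; zero; suc; splitAt; join; _↑ˡ_; _↑ʳ_)
open import Data.Fin.Properties using (join-splitAt) renaming (_≟_ to _≟F_)
open import Data.Vec.Functional using (_∷_; _++_; tail)
open import Data.Vec.Functional.Properties using (lookup-++ˡ; lookup-++ʳ)
open import Data.Product using (∃; _×_; _,_; proj₁; proj₂)
open import Data.Sum using ([_,_])
open import Data.Sum.Properties using ([,]-map)
open import Effect.Monad using (RawMonad)
open import Function using (_∘_)
open import Relation.Nullary using (¬_; Dec; yes; no)
open import Relation.Nullary.Decidable using (decidable-stable)
open import Relation.Nullary.Decidable.Core using (¬¬-excluded-middle)
open import Relation.Nullary.Negation using (¬¬-Monad)
open import Relation.Binary.Definitions using (Decidable)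
import Relation.Binary.PropositionalEquality as ≡
import Relation.Binary.Reasoning.Setoid as SetoidReasoning
import Algebra.Properties.AbelianGroup as AbelianGroupProperties
import Algebra.Properties.CommutativeSemigroup as CommutativeSemigroupProperties
import Algebra.Properties.Ring as RingProperties

module _ (K : FiniteField) where
  open FiniteField K hiding (zero) renaming (Carrier to 𝕂)
  open SetoidReasoning setoid
  private
    module +G = AbelianGroupProperties +-abelianGroup
    module +S = CommutativeSemigroupProperties +-commutativeSemigroup
    module R = RingProperties ring

  -- The only use of the finiteness of K.
  _≟_ : Decidable _≈_
  x ≟ y with enum-surj x | enum-surj y
  ... | i , eᵢ | j , eⱼ with i ≟F j
  ... | yes ≡.refl = yes (trans (sym eᵢ) eⱼ)
  ... | no i≢j = no λ x≈y → i≢j (enum-inj i j (trans eᵢ (trans x≈y (sym eⱼ))))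

  x+[y-x]≈y : ∀ x y → x + (y - x) ≈ y
  x+[y-x]≈y x y = begin
    x + (y - x) ≈⟨ +S.x∙yz≈y∙xz x y (- x) ⟩
    y + (x - x) ≈⟨ +-congˡ (-‿inverseʳ x) ⟩
    y + 0#      ≈⟨ +-identityʳ y ⟩
    y           ∎

  x-[x-y]≈y : ∀ x y → x - (x - y) ≈ y
  x-[x-y]≈y x y = trans (+-congˡ (+G.⁻¹-anti-homo‿- x y)) (x+[y-x]≈y x y)

  x≈y⇒x-y≈0 : ∀ {x y} → x ≈ y → x - y ≈ 0#
  x≈y⇒x-y≈0 = +G.x≈y⇒x∙y⁻¹≈ε

  [x+y]+[u+v]-[z+w]≈[x+u-z]+[y+v-w] : ∀ x y u v z w →
    ((x + y) + (u + v)) - (z + w) ≈ ((x + u) - z) + ((y + v) - w)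
  [x+y]+[u+v]-[z+w]≈[x+u-z]+[y+v-w] x y u v z w = begin
    ((x + y) + (u + v)) - (z + w)     ≈⟨ +-cong (+S.interchange x y u v) (sym (+G.⁻¹-∙-comm z w)) ⟩
    ((x + u) + (y + v)) + (- z + - w) ≈⟨ +S.interchange (x + u) (y + v) (- z) (- w) ⟩
    ((x + u) - z) + ((y + v) - w)     ∎

  c*x+c*y-c*z≈c*[x+y-z] : ∀ c x y z → (c * x + c * y) - c * z ≈ c * ((x + y) - z)
  c*x+c*y-c*z≈c*[x+y-z] c x y z = begin
    (c * x + c * y) - c * z ≈⟨ +-cong (sym (distribˡ c x y)) (R.-‿distribʳ-* c z) ⟩
    c * (x + y) + c * - z   ≈⟨ sym (distribˡ c (x + y) (- z)) ⟩
    c * ((x + y) - z)       ∎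

  Vec𝕂 : ℕ → Set
  Vec𝕂 n = Fin n → 𝕂

  Subset : ℕ → Set₁
  Subset n = Pred K (E K n)

  module _ {n : ℕ} where
    infix 4 _≋_ _⊆ᴱ_
    infixl 6 _⊞_ _⊟_
    infixr 7 _⊡_

    _≋_ : Vec𝕂 n → Vec𝕂 n → Set
    x ≋ y = ∀ i → x i ≈ y i

    0v : Vec𝕂 n
    0v _ = 0#

    _⊞_ _⊟_ : Vec𝕂 n → Vec𝕂 n → Vec𝕂 n
    (x ⊞ y) i = x i + y i
    (x ⊟ y) i = x i - y i

    ⊟_ : Vec𝕂 n → Vec𝕂 n
    (⊟ x) i = - x i

    _⊡_ : 𝕂 → Vec𝕂 n → Vec𝕂 n
    (c ⊡ x) i = c * x i

    IsSubspaceᴱ : Subset n → Set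
    IsSubspaceᴱ = IsSubspace K (E K n)

    HasDimᴱ : Subset n → ℕ → Set
    HasDimᴱ = HasDim K (E K n)

    _⊆ᴱ_ : Subset n → Subset n → Set
    _⊆ᴱ_ = _⊆_ K (E K n)

  _⧸_ : (n : ℕ) → Subset n → LinSpace K
  n ⧸ G = _/_ K n G

  lcᴱ : ∀ {n} d → (Fin d → 𝕂) → (Fin d → Vec𝕂 n) → Vec𝕂 n
  lcᴱ {n} = lc K (E K n)

  module Subspace {n} {S : Subset n} (sS : IsSubspaceᴱ S) where
    resp : ∀ {x y} → x ≋ y → S x → S y
    resp {x} {y} = proj₁ sS x y

    0∈ : S 0v
    0∈ = proj₁ (proj₂ sS)

    ⊞-closed : ∀ {x y} → S x → S y → S (x ⊞ y)
    ⊞-closed {x} {y} = proj₁ (proj₂ (proj₂ sS)) x y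

    ⊡-closed : ∀ c {x} → S x → S (c ⊡ x)
    ⊡-closed c {x} = proj₂ (proj₂ (proj₂ sS)) c x

    ⊟-closed : ∀ {x} → S x → S (⊟ x)
    ⊟-closed Sx = resp (λ i → R.-1*x≈-x _) (⊡-closed (- 1#) Sx)

    ≋0⇒∈ : ∀ {x} → x ≋ 0v → S x
    ≋0⇒∈ x≋0 = resp (λ i → sym (x≋0 i)) 0∈

    ≋⇒difference∈ : ∀ {x y} → x ≋ y → S (x ⊟ y)
    ≋⇒difference∈ x≋y = ≋0⇒∈ (λ i → x≈y⇒x-y≈0 (x≋y i))

    lc-closed : ∀ {d} c {v} → (∀ j → S (v j)) → S (lcᴱ d c v)
    lc-closed {zero} c v∈S = 0∈
    lc-closed {suc d} c v∈S = ⊞-closed (⊡-closed (c zero) (v∈S zero)) (lc-closed (c ∘ suc) (v∈S ∘ suc))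

  lc-cong : ∀ {n} d {c c′ : Fin d → 𝕂} {v v′ : Fin d → Vec𝕂 n} →
            (∀ j → c j ≈ c′ j) → (∀ j → v j ≋ v′ j) → lcᴱ d c v ≋ lcᴱ d c′ v′
  lc-cong zero c≈c′ v≋v′ i = refl
  lc-cong (suc d) c≈c′ v≋v′ i =
    +-cong (*-cong (c≈c′ zero) (v≋v′ zero i)) (lc-cong d (c≈c′ ∘ suc) (v≋v′ ∘ suc) i)

  lc-zeroˡ : ∀ {n} d {c : Fin d → 𝕂} (v : Fin d → Vec𝕂 n) → (∀ j → c j ≈ 0#) → lcᴱ d c v ≋ 0v
  lc-zeroˡ zero v c≈0 i = refl
  lc-zeroˡ (suc d) {c} v c≈0 i = begin
    c zero * v zero i + lcᴱ d (c ∘ suc) (v ∘ suc) i ≈⟨ +-cong (trans (*-congʳ (c≈0 zero)) (zeroˡ _)) (lc-zeroˡ d (v ∘ suc) (c≈0 ∘ suc) i) ⟩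
    0# + 0#                                         ≈⟨ +-identityˡ 0# ⟩
    0#                                              ∎

  lc-quotient : ∀ {n} (G : Subset n) d c v → lc K (n ⧸ G) d c v ≡.≡ lcᴱ d c v
  lc-quotient G zero c v = ≡.refl
  lc-quotient G (suc d) c v = ≡.cong (c zero ⊡ v zero ⊞_) (lc-quotient G d (c ∘ suc) (v ∘ suc))

  lc-∷ : ∀ {n} k c (b : Fin k → Vec𝕂 n) → lcᴱ k c (λ j → 0# ∷ b j) ≋ 0# ∷ lcᴱ k c b
  lc-∷ zero c b zero = refl
  lc-∷ zero c b (suc i) = refl
  lc-∷ (suc k) c b zero = trans (+-cong (zeroʳ (c zero)) (lc-∷ k (c ∘ suc) (b ∘ suc) zero)) (+-identityˡ 0#)
  lc-∷ (suc k) c b (suc i) = +-congˡ (lc-∷ k (c ∘ suc) (b ∘ suc) (suc i))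

  ++-suc : ∀ {A : Set} {a b} (v : Fin (suc a) → A) (w : Fin b → A) j → (v ++ w) (suc j) ≡.≡ (tail v ++ w) j
  ++-suc {a = a} v w j = [,]-map (splitAt a j)

  lc-++ : ∀ {n} a {b} c (v : Fin a → Vec𝕂 n) (w : Fin b → Vec𝕂 n) →
          lcᴱ (a +ℕ b) c (v ++ w) ≋ lcᴱ a (c ∘ (_↑ˡ b)) v ⊞ lcᴱ b (c ∘ (a ↑ʳ_)) w
  lc-++ zero c v w i = sym (+-identityˡ _)
  lc-++ (suc a) {b} c v w i = begin
    c zero * v zero i + lcᴱ (a +ℕ b) (c ∘ suc) ((v ++ w) ∘ suc) i
      ≈⟨ +-congˡ (lc-cong (a +ℕ b) (λ _ → refl) (λ j i → reflexive (≡.cong (λ u → u i) (++-suc v w j))) i) ⟩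
    c zero * v zero i + lcᴱ (a +ℕ b) (c ∘ suc) (tail v ++ w) i
      ≈⟨ +-congˡ (lc-++ a (c ∘ suc) (tail v) w i) ⟩
    c zero * v zero i + (lcᴱ a (c ∘ suc ∘ (_↑ˡ b)) (tail v) i + lcᴱ b (c ∘ suc ∘ (a ↑ʳ_)) w i)
      ≈⟨ sym (+-assoc _ _ _) ⟩
    (c zero * v zero i + lcᴱ a (c ∘ suc ∘ (_↑ˡ b)) (tail v) i) + lcᴱ b (c ∘ suc ∘ (a ↑ʳ_)) w i
      ∎

  ∀-↑ : ∀ {a b} {P : Fin (a +ℕ b) → Set} → (∀ i → P (i ↑ˡ b)) → (∀ j → P (a ↑ʳ j)) → ∀ i → P i
  ∀-↑ {a} {b} {P} left right i = ≡.subst P (join-splitAt a b i) ([_,_] {C = P ∘ join a b} left right (splitAt a i))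

  Slice : ∀ {m} → Subset (suc m) → Subset m
  Slice S y = S (0# ∷ y)

  slice-isSubspace : ∀ {m} {S : Subset (suc m)} → IsSubspaceᴱ S → IsSubspaceᴱ (Slice S)
  slice-isSubspace sS =
      (λ x y x≋y → resp λ { zero → refl ; (suc i) → x≋y i })
    , resp (λ { zero → refl ; (suc i) → refl }) 0∈
    , (λ x y Sx Sy → resp (λ { zero → +-identityˡ 0# ; (suc i) → refl }) (⊞-closed Sx Sy))
    , (λ c x Sx → resp (λ { zero → zeroʳ c ; (suc i) → refl }) (⊡-closed c Sx))
    where open Subspace sS

  module SliceBasis {m} {S : Subset (suc m)} (sS : IsSubspaceᴱ S) {k} (hb : HasDimᴱ (Slice S) k) where
    open Subspace sS
    private
      b : Fin k → Vec𝕂 m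
      b = proj₁ hb

      b∈Slice : ∀ j → Slice S (b j)
      b∈Slice = proj₁ (proj₂ hb)

      b-independent : ∀ c → lcᴱ k c b ≋ 0v → ∀ j → c j ≈ 0#
      b-independent = proj₁ (proj₂ (proj₂ hb))

      b-spans : ∀ y → Slice S y → ∃ λ c → lcᴱ k c b ≋ y
      b-spans = proj₂ (proj₂ (proj₂ hb))

    lifted : Fin k → Vec𝕂 (suc m)
    lifted j = 0# ∷ b j

    lifted-independent : ∀ c → lcᴱ k c lifted ≋ 0v → ∀ j → c j ≈ 0#
    lifted-independent c lc≋0 = b-independent c λ i → trans (sym (lc-∷ k c b (suc i))) (lc≋0 (suc i))

    lifted-spans : ∀ x → S x → x zero ≈ 0# → ∃ λ c → lcᴱ k c lifted ≋ x
    lifted-spans x Sx x₀≈0 with b-spans (tail x) (resp (λ { zero → x₀≈0 ; (suc i) → refl }) Sx)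
    ... | c , lc≋tail = c , λ { zero → trans (lc-∷ k c b zero) (sym x₀≈0)
                              ; (suc i) → trans (lc-∷ k c b (suc i)) (lc≋tail i) }

    hasDim-lifted : (∀ x → S x → x zero ≈ 0#) → HasDimᴱ S k
    hasDim-lifted x₀≈0 = lifted , b∈Slice , lifted-independent , λ x Sx → lifted-spans x Sx (x₀≈0 x Sx)

    hasDim-extended : ∀ u → S u → ¬ u zero ≈ 0# → HasDimᴱ S (suc k)
    hasDim-extended u Su u₀≉0 = u ∷ lifted , (λ { zero → Su ; (suc j) → b∈Slice j }) , independent , spans
      where
      u₀⁻¹ : 𝕂
      u₀⁻¹ = proj₁ (inverse (u zero) u₀≉0)

      u₀⁻¹*u₀≈1 : u₀⁻¹ * u zero ≈ 1#
      u₀⁻¹*u₀≈1 = trans (*-comm _ _) (proj₂ (inverse (u zero) u₀≉0))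

      independent : ∀ c → lcᴱ (suc k) c (u ∷ lifted) ≋ 0v → ∀ j → c j ≈ 0#
      independent c lc≋0 = λ { zero → c₀≈0 ; (suc j) → lifted-independent (c ∘ suc) rest≋0 j }
        where
        c₀≈0 : c zero ≈ 0#
        c₀≈0 = begin
          c zero                                        ≈⟨ *-identityʳ _ ⟨
          c zero * 1#                                   ≈⟨ *-congˡ u₀⁻¹*u₀≈1 ⟨
          c zero * (u₀⁻¹ * u zero)                      ≈⟨ *-congˡ (*-comm _ _) ⟩
          c zero * (u zero * u₀⁻¹)                      ≈⟨ *-assoc _ _ _ ⟨
          (c zero * u zero) * u₀⁻¹                      ≈⟨ *-congʳ (+-identityʳ _) ⟨
          (c zero * u zero + 0#) * u₀⁻¹                 ≈⟨ *-congʳ (+-congˡ (lc-∷ k (c ∘ suc) b zero)) ⟨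
          (c zero * u zero + lcᴱ k (c ∘ suc) lifted zero) * u₀⁻¹ ≈⟨ *-congʳ (lc≋0 zero) ⟩
          0# * u₀⁻¹                                     ≈⟨ zeroˡ _ ⟩
          0#                                            ∎

        rest≋0 : lcᴱ k (c ∘ suc) lifted ≋ 0v
        rest≋0 i = begin
          lcᴱ k (c ∘ suc) lifted i                  ≈⟨ +-identityˡ _ ⟨
          0# + lcᴱ k (c ∘ suc) lifted i             ≈⟨ +-congʳ (trans (*-congʳ c₀≈0) (zeroˡ _)) ⟨
          c zero * u i + lcᴱ k (c ∘ suc) lifted i   ≈⟨ lc≋0 i ⟩
          0#                                        ∎

      spans : ∀ x → S x → ∃ λ c → lcᴱ (suc k) c (u ∷ lifted) ≋ x
      spans x Sx = t ∷ proj₁ rest , λ i → trans (+-congˡ (proj₂ rest i)) (x+[y-x]≈y _ _)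
        where
        t : 𝕂
        t = x zero * u₀⁻¹

        t*u₀≈x₀ : t * u zero ≈ x zero
        t*u₀≈x₀ = begin
          (x zero * u₀⁻¹) * u zero ≈⟨ *-assoc _ _ _ ⟩
          x zero * (u₀⁻¹ * u zero) ≈⟨ *-congˡ u₀⁻¹*u₀≈1 ⟩
          x zero * 1#              ≈⟨ *-identityʳ _ ⟩
          x zero                   ∎

        rest : ∃ λ c → lcᴱ k c lifted ≋ x ⊟ t ⊡ u
        rest = lifted-spans (x ⊟ t ⊡ u) (⊞-closed Sx (⊟-closed (⊡-closed t Su))) (x≈y⇒x-y≈0 (sym t*u₀≈x₀))

  FiniteDimensional : ∀ {n} → Subset n → Set
  FiniteDimensional S = ∃ (HasDimᴱ S)

  -- A basis of the slice x₀ = 0, extended by a vector of S with x₀ ≉ 0 if there is one.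
  ¬¬-finiteDimensional : ∀ {n} {S : Subset n} → IsSubspaceᴱ S → ¬ ¬ FiniteDimensional S
  ¬¬-finiteDimensional {zero} sS = return (0 , (λ ()) , (λ ()) , (λ _ _ ()) , λ _ _ → (λ ()) , λ ())
    where open RawMonad ¬¬-Monad
  ¬¬-finiteDimensional {suc m} {S} sS = do
      (k , hb) ← ¬¬-finiteDimensional (slice-isSubspace sS)
      u? ← ¬¬-excluded-middle
      return (extend hb u?)
    where
    open RawMonad ¬¬-Monad
    extend : ∀ {k} → HasDimᴱ (Slice S) k → Dec (∃ λ u → S u × ¬ u zero ≈ 0#) → FiniteDimensional S
    extend hb (yes (u , Su , u₀≉0)) = _ , SliceBasis.hasDim-extended sS hb u Su u₀≉0
    extend hb (no ∄u) = _ , SliceBasis.hasDim-lifted sS hb λ x Sx →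
      decidable-stable (x zero ≟ 0#) λ x₀≉0 → ∄u (x , Sx , x₀≉0)

  +-isSubspace : ∀ {n} {A B : Subset n} → IsSubspaceᴱ A → IsSubspaceᴱ B → IsSubspaceᴱ (_+ₛ_ K (E K n) A B)
  +-isSubspace sA sB =
      (λ { z z′ z≋z′ (a , b , Aa , Bb , a+b≋z) → a , b , Aa , Bb , λ i → trans (a+b≋z i) (z≋z′ i) })
    , (0v , 0v , A.0∈ , B.0∈ , λ i → +-identityˡ 0#)
    , (λ { z z′ (a , b , Aa , Bb , a+b≋z) (a′ , b′ , Aa′ , Bb′ , a′+b′≋z′) →
           a ⊞ a′ , b ⊞ b′ , A.⊞-closed Aa Aa′ , B.⊞-closed Bb Bb′ ,
           λ i → trans (+S.interchange (a i) (a′ i) (b i) (b′ i)) (+-cong (a+b≋z i) (a′+b′≋z′ i)) })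
    , (λ { c z (a , b , Aa , Bb , a+b≋z) → c ⊡ a , c ⊡ b , A.⊡-closed c Aa , B.⊡-closed c Bb ,
           λ i → trans (sym (distribˡ c (a i) (b i))) (*-congˡ (a+b≋z i)) })
    where
    module A = Subspace sA
    module B = Subspace sB

  module Quotient {n} {G : Subset n} (sG : IsSubspaceᴱ G) where
    private module G = Subspace sG

    IsSubspaceᴳ : Subset n → Set
    IsSubspaceᴳ = IsSubspace K (n ⧸ G)

    _+ᴳ_ : Subset n → Subset n → Subset n
    _+ᴳ_ = _+ₛ_ K (n ⧸ G)

    subspaceᴳ⇒subspace : ∀ {A} → IsSubspaceᴳ A → IsSubspaceᴱ A
    subspaceᴳ⇒subspace (resp , closed) = (λ x y x≋y → resp x y (G.≋⇒difference∈ x≋y)) , closed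

    subspaceᴳ⇒⊇ : ∀ {A} → IsSubspaceᴳ A → G ⊆ᴱ A
    subspaceᴳ⇒⊇ (resp , 0∈A , _) y Gy = resp 0v y (G.resp (λ i → sym (+-identityˡ _)) (G.⊟-closed Gy)) 0∈A

    subspace⊇⇒subspaceᴳ : ∀ {A} → IsSubspaceᴱ A → G ⊆ᴱ A → IsSubspaceᴳ A
    subspace⊇⇒subspaceᴳ sA G⊆A =
        (λ x y x-y∈G Ax → A.resp (λ i → x-[x-y]≈y (x i) (y i)) (A.⊞-closed Ax (A.⊟-closed (G⊆A _ x-y∈G))))
      , proj₂ sA
      where module A = Subspace sA

    +ᴳ-isSubspace : ∀ {A B} → IsSubspaceᴱ A → IsSubspaceᴱ B → IsSubspaceᴱ (A +ᴳ B)
    +ᴳ-isSubspace sA sB =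
        (λ { z z′ z≋z′ (a , b , Aa , Bb , g) → a , b , Aa , Bb , G.resp (λ i → +-congˡ (-‿cong (z≋z′ i))) g })
      , (0v , 0v , A.0∈ , B.0∈ , G.≋0⇒∈ (λ i → x≈y⇒x-y≈0 (+-identityˡ 0#)))
      , (λ { z z′ (a , b , Aa , Bb , g) (a′ , b′ , Aa′ , Bb′ , g′) →
             a ⊞ a′ , b ⊞ b′ , A.⊞-closed Aa Aa′ , B.⊞-closed Bb Bb′ ,
             G.resp (λ i → sym ([x+y]+[u+v]-[z+w]≈[x+u-z]+[y+v-w] (a i) (a′ i) (b i) (b′ i) (z i) (z′ i)))
                    (G.⊞-closed g g′) })
      , (λ { c z (a , b , Aa , Bb , g) → c ⊡ a , c ⊡ b , A.⊡-closed c Aa , B.⊡-closed c Bb ,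
             G.resp (λ i → sym (c*x+c*y-c*z≈c*[x+y-z] c (a i) (b i) (z i))) (G.⊡-closed c g) })
      where
      module A = Subspace sA
      module B = Subspace sB

    hasDim-+ : ∀ {A d g} → G ⊆ᴱ A → HasDim K (n ⧸ G) A d → HasDimᴱ G g → HasDimᴱ A (d +ℕ g)
    hasDim-+ {A} {d} {g} G⊆A (w , w∈A , w-independent , w-spans) (u , u∈G , u-independent , u-spans) =
      w ++ u , ∀-↑ {P = A ∘ (w ++ u)} w++u∈A-left w++u∈A-right , independent , spans
      where
      w++u∈A-left : ∀ i → A ((w ++ u) (i ↑ˡ g))
      w++u∈A-left i = ≡.subst A (≡.sym (lookup-++ˡ w u i)) (w∈A i)

      w++u∈A-right : ∀ j → A ((w ++ u) (d ↑ʳ j))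
      w++u∈A-right j = ≡.subst A (≡.sym (lookup-++ʳ w u j)) (G⊆A _ (u∈G j))

      independent : ∀ c → lcᴱ (d +ℕ g) c (w ++ u) ≋ 0v → ∀ i → c i ≈ 0#
      independent c lc≋0 = ∀-↑ {P = λ i → c i ≈ 0#} left≈0 right≈0
        where
        L R : Vec𝕂 n
        L = lcᴱ d (c ∘ (_↑ˡ g)) w
        R = lcᴱ g (c ∘ (d ↑ʳ_)) u

        L+R≋0 : L ⊞ R ≋ 0v
        L+R≋0 i = trans (sym (lc-++ d c w u i)) (lc≋0 i)

        -R≋L-0 : ⊟ R ≋ L ⊟ 0v
        -R≋L-0 i = begin
          - R i    ≈⟨ +G.inverseˡ-unique (L i) (R i) (L+R≋0 i) ⟨
          L i      ≈⟨ +-identityʳ _ ⟨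
          L i + 0# ≈⟨ +-congˡ +G.ε⁻¹≈ε ⟨
          L i - 0# ∎

        left≈0 : ∀ i → c (i ↑ˡ g) ≈ 0#
        left≈0 = w-independent _ (≡.subst (λ v → G (v ⊟ 0v)) (≡.sym (lc-quotient G d _ w))
                                    (G.resp -R≋L-0 (G.⊟-closed (G.lc-closed _ u∈G))))

        right≈0 : ∀ j → c (d ↑ʳ j) ≈ 0#
        right≈0 = u-independent _ λ i → begin
          R i       ≈⟨ +-identityˡ _ ⟨
          0# + R i  ≈⟨ +-congʳ (lc-zeroˡ d w left≈0 i) ⟨
          L i + R i ≈⟨ L+R≋0 i ⟩
          0#        ∎

      spans : ∀ x → A x → ∃ λ c → lcᴱ (d +ℕ g) c (w ++ u) ≋ x
      spans x Ax = c₁ ++ c₂ , λ i → begin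
        lcᴱ (d +ℕ g) (c₁ ++ c₂) (w ++ u) i
          ≈⟨ lc-++ d (c₁ ++ c₂) w u i ⟩
        lcᴱ d ((c₁ ++ c₂) ∘ (_↑ˡ g)) w i + lcᴱ g ((c₁ ++ c₂) ∘ (d ↑ʳ_)) u i
          ≈⟨ +-cong (lc-cong d (λ j → reflexive (lookup-++ˡ c₁ c₂ j)) (λ _ _ → refl) i)
                    (lc-cong g (λ j → reflexive (lookup-++ʳ c₁ c₂ j)) (λ _ _ → refl) i) ⟩
        L i + lcᴱ g c₂ u i
          ≈⟨ +-congˡ (proj₂ (u-spans (x ⊟ L) x-L∈G) i) ⟩
        L i + (x i - L i)
          ≈⟨ x+[y-x]≈y _ _ ⟩
        x i ∎
        where
        c₁ : Fin d → 𝕂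
        c₁ = proj₁ (w-spans x Ax)

        L : Vec𝕂 n
        L = lcᴱ d c₁ w

        x-L∈G : G (x ⊟ L)
        x-L∈G = G.resp (λ i → +G.⁻¹-anti-homo‿- (L i) (x i))
                  (G.⊟-closed (≡.subst (λ v → G (v ⊟ x)) (lc-quotient G d c₁ w) (proj₂ (w-spans x Ax))))

        c₂ : Fin g → 𝕂
        c₂ = proj₁ (u-spans (x ⊟ L) x-L∈G)

  line : ∀ {n} → Vec𝕂 n → Subset n
  line b y = ∃ λ c → y ≋ c ⊡ b

  line-∋ : ∀ {n} (b : Vec𝕂 n) → line b b
  line-∋ b = 1# , λ i → sym (*-identityˡ (b i))

  line-isSubspace : ∀ {n} (b : Vec𝕂 n) → IsSubspaceᴱ (line b)
  line-isSubspace b =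
      (λ { y y′ y≋y′ (c , y≋cb) → c , λ i → trans (sym (y≋y′ i)) (y≋cb i) })
    , (0# , λ i → sym (zeroˡ (b i)))
    , (λ { y y′ (c , y≋cb) (c′ , y′≋c′b) →
           c + c′ , λ i → trans (+-cong (y≋cb i) (y′≋c′b i)) (sym (distribʳ (b i) c c′)) })
    , (λ { d y (c , y≋cb) → d * c , λ i → trans (*-congˡ (y≋cb i)) (sym (*-assoc d c (b i))) })

  line-hasDim₁ : ∀ {n} {b : Vec𝕂 n} → ¬ b ≋ 0v → HasDimᴱ (line b) 1
  line-hasDim₁ {b = b} b≉0 =
    (λ _ → b) , (λ _ → line-∋ b) , independent , λ { y (c , y≋cb) → (λ _ → c) , λ i → trans (+-identityʳ _) (sym (y≋cb i)) }
    where
    independent : ∀ c → lcᴱ 1 c (λ _ → b) ≋ 0v → ∀ j → c j ≈ 0#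
    independent c cb≋0 zero = decidable-stable (c zero ≟ 0#) λ c₀≉0 →
      let c₀⁻¹ = proj₁ (inverse (c zero) c₀≉0) in
      b≉0 λ i → begin
        b i                   ≈⟨ *-identityˡ _ ⟨
        1# * b i              ≈⟨ *-congʳ (trans (*-comm _ _) (proj₂ (inverse (c zero) c₀≉0))) ⟨
        (c₀⁻¹ * c zero) * b i ≈⟨ *-assoc _ _ _ ⟩
        c₀⁻¹ * (c zero * b i) ≈⟨ *-congˡ (trans (sym (+-identityʳ _)) (cb≋0 i)) ⟩
        c₀⁻¹ * 0#             ≈⟨ zeroʳ _ ⟩
        0#                    ∎

  module _ {n} (M : QMatroid K n) {G F : Subset n} (sG : IsSubspaceᴱ G) (G⊆F : G ⊆ᴱ F) where
    open QMatroid M using (r; R2)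
    open Quotient sG
    private module G = Subspace sG

    contraction-isFlat : IsFlat K (E K n) r F → IsFlat K (n ⧸ G) (contractionRank K M G) F
    contraction-isFlat (sF , F-flat) = sFᴳ , flat
      where
      module F = Subspace sF

      sFᴳ : IsSubspaceᴳ F
      sFᴳ = subspace⊇⇒subspaceᴳ sF G⊆F

      flat : ∀ x → IsSubspaceᴳ x → HasDim K (n ⧸ G) x 1 → ¬ x ⊆ᴱ F → r F ∸ r G < r (F +ᴳ x) ∸ r G
      flat x sx (v , v∈x , _ , v-spans) x⊈F =
        ∸-monoˡ-< (<-≤-trans (F-flat (line b) (line-isSubspace b) (line-hasDim₁ b≉0) line⊈F)
                             (R2 _ _ (+-isSubspace sF (line-isSubspace b)) (+ᴳ-isSubspace sF sxᴱ) F+line⊆F+x))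
                  (R2 G F sG sF G⊆F)
        where
        sxᴱ : IsSubspaceᴱ x
        sxᴱ = subspaceᴳ⇒subspace sx

        b : Vec𝕂 n
        b = v zero

        b∉F : ¬ F b
        b∉F Fb = x⊈F λ y y∈x →
          proj₁ sFᴳ _ y (proj₂ (v-spans y y∈x)) (F.⊞-closed (F.⊡-closed _ Fb) F.0∈)

        b≉0 : ¬ b ≋ 0v
        b≉0 b≋0 = b∉F (F.≋0⇒∈ b≋0)

        line⊈F : ¬ line b ⊆ᴱ F
        line⊈F line⊆F = b∉F (line⊆F b (line-∋ b))

        F+line⊆F+x : _+ₛ_ K (E K n) F (line b) ⊆ᴱ F +ᴳ x
        F+line⊆F+x z (a , y , Fa , (c , y≋cb) , a+y≋z) =
          a , c ⊡ b , Fa , Subspace.⊡-closed sxᴱ c (v∈x zero) ,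
          G.≋⇒difference∈ (λ i → trans (+-congˡ (sym (y≋cb i))) (a+y≋z i))

    -- Constructively a basis of G exists only up to double negation; that suffices
    -- because equality of ranks is decidable.
    contraction-isCyclic : IsCyclic K (E K n) r F → IsCyclic K (n ⧸ G) (contractionRank K M G) F
    contraction-isCyclic (sF , F-cyclic) = subspace⊇⇒subspaceᴳ sF G⊆F , cyclic
      where
      open RawMonad ¬¬-Monad

      cyclic : ∀ B → IsSubspaceᴳ B → B ⊆ᴱ F → CodimOne K (n ⧸ G) B F → r B ∸ r G ≡.≡ r F ∸ r G
      cyclic B sB B⊆F (d , F-dim , B-dim) = ≡.cong (_∸ r G) (decidable-stable (r B ≟ℕ r F) do
        (g , G-dim) ← ¬¬-finiteDimensional sG
        return (F-cyclic B (subspaceᴳ⇒subspace sB) B⊆F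
                  (d +ℕ g , hasDim-+ G⊆F F-dim G-dim , hasDim-+ (subspaceᴳ⇒⊇ sB) B-dim G-dim)))

lemma3p1 : (K : FiniteField) → IsPrimePower (FiniteField.size K) →
    (n : ℕ) (M : QMatroid K n) (F G : Pred K (E K n)) →
    IsCyclicFlat K (E K n) (QMatroid.r M) F →
    IsSubspace K (E K n) G → _⊆_ K (E K n) G F → ¬ (_⊆_ K (E K n) F G) →
    IsCyclicFlat K (_/_ K n G) (contractionRank K M G) (quotSub K F G)
lemma3p1 K _ n M F G (F-flat , F-cyclic) sG G⊆F _ =
  contraction-isFlat K M sG G⊆F F-flat , contraction-isCyclic K M sG G⊆F F-cyclic
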